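{- Let $0<q<1$, let $a,b,c,d\in\mathbb{C}$ be generic, and let $n$ be a positive integer. Then \begin{multline*} ab(1-q^{n-1})(1-cdq^{n-2})\,p_n(x;a,b,c,d;q)\,p_{n-2}(x;aq,bq,c,d;q)\\ =(1-abq^{n-1})(1-abcdq^{n-1})\,p_{n-1}(x;a,b,c,d;q)\,p_{n-1}(x;aq,bq,c,d;q)\\ -(1-ab)(1-abcdq^{2n-2})\,p_{n-1}(x;aq,b,c,d;q)\,p_{n-1}(x;a,bq,c,d;q). \end{multline*}
   Context: $(a;q)_n=\prod_{k=0}^{n-1}(1-aq^k)$ for $n\ge0$, and $(a_1,\dots,a_m;q)_n=\prod_i(a_i;q)_n$. The Askey–Wilson polynomials are, with $x=\cos\theta$ and $I^2=-1$, $p_n(x;a,b,c,d;q)=\frac{(ab,ac,ad;q)_n}{a^n}\sum_{k=0}^{n}\frac{(q^{ -n},abcdq^{n-1},ae^{I\theta},ae^{ -I\theta};q)_k}{(q,ab,ac,ad;q)_k}q^k,$ a polynomial of degree $n$ in $x$. -}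

module Defs where

open import Level using (Level; suc; _⊔_)
open import Data.Nat using (ℕ; zero; _∸_) renaming (suc to sucℕ)
open import Relation.Nullary using (¬_)
open import Algebra.Bundles using (CommutativeRing)

record Field (c ℓ : Level) : Set (suc (c ⊔ ℓ)) where
  field
    commutativeRing : CommutativeRing c ℓ
  open CommutativeRing commutativeRing public
  field
    _⁻¹     : Carrier → Carrier
    0≉1     : ¬ (0# ≈ 1#)
    ⁻¹-inverse : ∀ x → ¬ (x ≈ 0#) → x * (x ⁻¹) ≈ 1#

module AskeyWilson {c ℓ : Level} (F : Field c ℓ) where
  open Field F hiding (zero)

  infixr 8 _^_
  _^_ : Carrier → ℕ → Carrier
  y ^ zero = 1#
  y ^ sucℕ n = (y ^ n) * y

  two : Carrier
  two = 1# + 1#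

  poch : Carrier → Carrier → ℕ → Carrier
  poch a q zero = 1#
  poch a q (sucℕ n) = poch a q n * (1# - a * q ^ n)

  -- (a e^{iθ}, a e^{-iθ}; q)_k written in terms of x = cos θ:
  -- ∏_{j<k} (1 - a q^j e^{iθ})(1 - a q^j e^{-iθ}) = ∏_{j<k} (1 - 2 a x q^j + a² q^{2j})
  pochθ : Carrier → Carrier → Carrier → ℕ → Carrier
  pochθ a q x zero = 1#
  pochθ a q x (sucℕ k) =
    pochθ a q x k * ((1# - two * a * x * q ^ k) + (a * a) * (q ^ k * q ^ k))

  sumTo : (ℕ → Carrier) → ℕ → Carrier
  sumTo f zero = f zero
  sumTo f (sucℕ n) = sumTo f n + f (sucℕ n)

  -- Askey–Wilson polynomial p_n(x;a,b,c,d;q), literally as in the definition: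
  -- (ab,ac,ad;q)_n / a^n · Σ_{k=0}^n (q^{-n}, abcd q^{n-1}, ae^{iθ}, ae^{-iθ};q)_k
  --                                    / (q,ab,ac,ad;q)_k · q^k
  -- (q^{-n} is (q⁻¹)^n; abcd q^{n-1} for n = 0 is only used with k = 0, where
  --  the Pochhammer symbol is 1, so the truncation n ∸ 1 is harmless.)
  p : ℕ → Carrier → Carrier → Carrier → Carrier → Carrier → Carrier → Carrier
  p n x a b c d q =
    ((poch (a * b) q n * poch (a * c) q n * poch (a * d) q n) * ((a ^ n) ⁻¹))
    * sumTo (λ k →
        (poch ((q ⁻¹) ^ n) q k * poch (a * b * c * d * q ^ (n ∸ 1)) q k
           * pochθ a q x k)
        * ((poch q q k * poch (a * b) q k * poch (a * c) q k * poch (a * d) q k) ⁻¹)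
        * q ^ k) n

  -- genericity of the parameters: every denominator occurring in the
  -- Askey–Wilson polynomials of the theorem is nonzero (with room to spare).
  Generic : Carrier → Carrier → Carrier → Carrier → Carrier → Set ℓ
  Generic q a b c d =
    (¬ (q ≈ 0#)) Data.Product.× (¬ (a ≈ 0#)) Data.Product.×
    (∀ (j : ℕ) → ¬ (q ^ sucℕ j ≈ 1#)) Data.Product.×
    (∀ (j : ℕ) → ¬ (a * b * q ^ j ≈ 1#)) Data.Product.×
    (∀ (j : ℕ) → ¬ (a * c * q ^ j ≈ 1#)) Data.Product.×
    (∀ (j : ℕ) → ¬ (a * d * q ^ j ≈ 1#))
    where import Data.Product

-- Write pₙ = (ab, ac, ad; q)ₙ a⁻ⁿ Sₙ(a, b), where Sₙ(a, b) is the terminating ₄φ₃ sum, and put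
-- n = m + 2 and u = (1 - a e^{iθ})(1 - a e^{-iθ}).  Comparing the sums term by term, after shifting
-- the summation index by one (which turns a, b into aq, bq), gives three contiguous relations
--   Sₘ₊₁(a, b) - Sₘ₊₁(a, bq) = τ₁ u Sₘ(aq, bq),
--   Sₘ₊₂(a, b) - Sₘ₊₁(a, bq) = τ₂ u Sₘ₊₁(aq, bq),
--   γ Sₘ₊₁(aq, b) = β Sₘ₊₁(aq, bq) - α Sₘ(aq, bq),
-- with α τ₂ = β τ₁.  Eliminating Sₘ₊₁(a, bq) and u leaves
--   α Sₘ₊₂(a, b) Sₘ(aq, bq) - β Sₘ₊₁(a, b) Sₘ₊₁(aq, bq) + γ Sₘ₊₁(aq, b) Sₘ₊₁(a, bq) = 0,
-- which is the identity once the Pochhammer prefactors are restored.  For n = 1 both sides vanish.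

module Submission where

open import Defs
open import Level using (Level)
open import Data.Nat using (ℕ; zero; suc; _∸_; _≤_)
import Data.Nat as ℕ
open import Data.Product using (_,_)
open import Algebra.Bundles using (CommutativeRing)

-- The ring solver over an arbitrary commutative ring, with integer coefficients interpreted as
-- n × 1#: unlike the solvers with coefficients in the ring itself, it needs no decidable equality.
module IntegerCoefficientSolver {c ℓ : Level} (R : CommutativeRing c ℓ) where

  open import Data.Nat.Properties using (+-suc)
  open import Data.Integer as ℤ using (ℤ; +_; -[1+_]; _⊖_; sign; ∣_∣; _◃_)
  import Data.Integer.Properties as ℤ
  import Data.Sign as Sign
  open import Data.Maybe using (Maybe; just; nothing)
  open import Relation.Nullary using (yes; no)
  import Relation.Binary.PropositionalEquality as ≡
  open import Algebra.Solver.Ring.AlmostCommutativeRing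
    using (fromCommutativeRing; _-Raw-AlmostCommutative⟶_)

  open CommutativeRing R
  open import Algebra.Properties.Ring ring using (-‿involutive; -‿distribˡ-*; -0#≈0#)
  open import Algebra.Properties.AbelianGroup +-abelianGroup using (⁻¹-∙-comm)
  open import Algebra.Properties.CommutativeSemigroup *-commutativeSemigroup using (interchange)
  open import Algebra.Properties.Semiring.Mult.TCOptimised semiring
    using (_×_; ×-cong; 1+×; ×-homo-+; ×1-homo-*)
  open import Relation.Binary.Reasoning.Setoid setoid

  ⟦_⟧ℤ : ℤ → Carrier
  ⟦ + n ⟧ℤ = n × 1#
  ⟦ -[1+ n ] ⟧ℤ = - (suc n × 1#)

  [1+x]-[1+y]≈x-y : ∀ x y → (1# + x) - (1# + y) ≈ x - y
  [1+x]-[1+y]≈x-y x y = begin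
    (1# + x) - (1# + y)        ≈⟨ +-congˡ (sym (⁻¹-∙-comm 1# y)) ⟩
    (1# + x) + (- 1# - y)      ≈⟨ +-congʳ (+-comm 1# x) ⟩
    (x + 1#) + (- 1# - y)      ≈⟨ +-assoc x 1# _ ⟩
    x + (1# + (- 1# - y))      ≈⟨ +-congˡ (sym (+-assoc 1# (- 1#) (- y))) ⟩
    x + ((1# - 1#) - y)        ≈⟨ +-congˡ (+-congʳ (-‿inverseʳ 1#)) ⟩
    x + (0# - y)               ≈⟨ +-congˡ (+-identityˡ (- y)) ⟩
    x - y                      ∎

  ⊖-homo : ∀ m n → ⟦ m ⊖ n ⟧ℤ ≈ m × 1# - n × 1#
  ⊖-homo zero zero = sym (trans (+-congˡ -0#≈0#) (+-identityʳ 0#))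
  ⊖-homo zero (suc n) = sym (+-identityˡ _)
  ⊖-homo (suc m) zero = sym (trans (+-congˡ -0#≈0#) (+-identityʳ _))
  ⊖-homo (suc m) (suc n) rewrite ℤ.[1+m]⊖[1+n]≡m⊖n m n =
    trans (⊖-homo m n) (sym (trans (+-cong (1+× m 1#) (-‿cong (1+× n 1#))) ([1+x]-[1+y]≈x-y (m × 1#) (n × 1#))))

  +-homo : ∀ i j → ⟦ i ℤ.+ j ⟧ℤ ≈ ⟦ i ⟧ℤ + ⟦ j ⟧ℤ
  +-homo (+ m) (+ n) = ×-homo-+ 1# m n
  +-homo (+ m) -[1+ n ] = ⊖-homo m (suc n)
  +-homo -[1+ m ] (+ n) = trans (⊖-homo n (suc m)) (+-comm _ _)
  +-homo -[1+ m ] -[1+ n ] = begin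
    - (suc (suc m ℕ.+ n) × 1#)           ≈⟨ -‿cong (×-cong (≡.cong suc (≡.sym (+-suc m n))) refl) ⟩
    - ((suc m ℕ.+ suc n) × 1#)           ≈⟨ -‿cong (×-homo-+ 1# (suc m) (suc n)) ⟩
    - (suc m × 1# + suc n × 1#)          ≈⟨ sym (⁻¹-∙-comm _ _) ⟩
    - (suc m × 1#) + - (suc n × 1#)      ∎

  ⟦_⟧± : Sign.Sign → Carrier
  ⟦ Sign.+ ⟧± = 1#
  ⟦ Sign.- ⟧± = - 1#

  ◃-homo : ∀ s n → ⟦ s ◃ n ⟧ℤ ≈ ⟦ s ⟧± * (n × 1#)
  ◃-homo Sign.- zero = sym (zeroʳ _)
  ◃-homo Sign.+ zero = sym (zeroʳ _)
  ◃-homo Sign.+ (suc n) = sym (*-identityˡ _)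
  ◃-homo Sign.- (suc n) = trans (-‿cong (sym (*-identityˡ _))) (-‿distribˡ-* 1# _)

  sign-abs-homo : ∀ i → ⟦ i ⟧ℤ ≈ ⟦ sign i ⟧± * (∣ i ∣ × 1#)
  sign-abs-homo (+ n) = sym (*-identityˡ _)
  sign-abs-homo -[1+ n ] = trans (-‿cong (sym (*-identityˡ _))) (-‿distribˡ-* 1# _)

  sign-*-homo : ∀ s t → ⟦ s Sign.* t ⟧± ≈ ⟦ s ⟧± * ⟦ t ⟧±
  sign-*-homo Sign.+ Sign.+ = sym (*-identityˡ _)
  sign-*-homo Sign.+ Sign.- = sym (*-identityˡ _)
  sign-*-homo Sign.- Sign.+ = sym (*-identityʳ _)
  sign-*-homo Sign.- Sign.- = begin
    1#             ≈⟨ sym (-‿involutive 1#) ⟩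
    - - 1#         ≈⟨ -‿cong (sym (*-identityˡ _)) ⟩
    - (1# * - 1#)  ≈⟨ -‿distribˡ-* 1# (- 1#) ⟩
    - 1# * - 1#    ∎

  *-homo : ∀ i j → ⟦ i ℤ.* j ⟧ℤ ≈ ⟦ i ⟧ℤ * ⟦ j ⟧ℤ
  *-homo i j = begin
    ⟦ (sign i Sign.* sign j) ◃ (∣ i ∣ ℕ.* ∣ j ∣) ⟧ℤ
      ≈⟨ ◃-homo (sign i Sign.* sign j) (∣ i ∣ ℕ.* ∣ j ∣) ⟩
    ⟦ sign i Sign.* sign j ⟧± * ((∣ i ∣ ℕ.* ∣ j ∣) × 1#)
      ≈⟨ *-cong (sign-*-homo (sign i) (sign j)) (×1-homo-* ∣ i ∣ ∣ j ∣) ⟩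
    (⟦ sign i ⟧± * ⟦ sign j ⟧±) * ((∣ i ∣ × 1#) * (∣ j ∣ × 1#))
      ≈⟨ interchange _ _ _ _ ⟩
    (⟦ sign i ⟧± * (∣ i ∣ × 1#)) * (⟦ sign j ⟧± * (∣ j ∣ × 1#))
      ≈⟨ sym (*-cong (sign-abs-homo i) (sign-abs-homo j)) ⟩
    ⟦ i ⟧ℤ * ⟦ j ⟧ℤ ∎

  -‿homo : ∀ i → ⟦ ℤ.- i ⟧ℤ ≈ - ⟦ i ⟧ℤ
  -‿homo (+ zero) = sym -0#≈0#
  -‿homo (+ suc n) = refl
  -‿homo -[1+ n ] = sym (-‿involutive _)

  ⟦⟧ℤ-morphism : ℤ.+-*-rawRing -Raw-AlmostCommutative⟶ fromCommutativeRing R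
  ⟦⟧ℤ-morphism = record
    { ⟦_⟧ = ⟦_⟧ℤ ; +-homo = +-homo ; *-homo = *-homo ; -‿homo = -‿homo
    ; 0-homo = refl ; 1-homo = refl }

  ⟦⟧ℤ-≟ : ∀ i j → Maybe (⟦ i ⟧ℤ ≈ ⟦ j ⟧ℤ)
  ⟦⟧ℤ-≟ i j with i ℤ.≟ j
  ... | yes ≡.refl = just refl
  ... | no _ = nothing

  open import Algebra.Solver.Ring ℤ.+-*-rawRing (fromCommutativeRing R) ⟦⟧ℤ-morphism ⟦⟧ℤ-≟ public

  :0 :1 : ∀ {n} → Polynomial n
  :0 = con (+ 0)
  :1 = con (+ 1)

module FieldProperties {c ℓ : Level} (F : Field c ℓ) where

  open import Relation.Nullary using (¬_)
  open Field F hiding (zero)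
  open AskeyWilson F using (_^_)
  open IntegerCoefficientSolver commutativeRing using (solve; _:=_; _:+_; _:*_; _:-_; :0; :1)
  open import Relation.Binary.Reasoning.Setoid setoid

  NonZero : Carrier → Set ℓ
  NonZero x = ¬ (x ≈ 0#)

  1≉0 : NonZero 1#
  1≉0 1≈0 = 0≉1 (sym 1≈0)

  x*x⁻¹≈1 : ∀ {x} → NonZero x → x * x ⁻¹ ≈ 1#
  x*x⁻¹≈1 {x} = ⁻¹-inverse x

  x⁻¹*x≈1 : ∀ {x} → NonZero x → x ⁻¹ * x ≈ 1#
  x⁻¹*x≈1 x≉0 = trans (*-comm _ _) (x*x⁻¹≈1 x≉0)

  x*y⁻¹*y≈x : ∀ {x y} → NonZero y → x * y ⁻¹ * y ≈ x
  x*y⁻¹*y≈x {x} {y} y≉0 = begin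
    x * y ⁻¹ * y    ≈⟨ *-assoc x (y ⁻¹) y ⟩
    x * (y ⁻¹ * y)  ≈⟨ *-congˡ (x⁻¹*x≈1 y≉0) ⟩
    x * 1#          ≈⟨ *-identityʳ x ⟩
    x               ∎

  *-cancelˡ : ∀ {k x y} → NonZero k → k * x ≈ k * y → x ≈ y
  *-cancelˡ {k} {x} {y} k≉0 kx≈ky = begin
    x               ≈⟨ sym (x*y⁻¹*y≈x k≉0) ⟩
    x * k ⁻¹ * k    ≈⟨ solve 3 (λ x k k' → x :* k' :* k := k' :* (k :* x)) refl x k (k ⁻¹) ⟩
    k ⁻¹ * (k * x)  ≈⟨ *-congˡ kx≈ky ⟩
    k ⁻¹ * (k * y)  ≈⟨ solve 3 (λ y k k' → k' :* (k :* y) := y :* k' :* k) refl y k (k ⁻¹) ⟩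
    y * k ⁻¹ * k    ≈⟨ x*y⁻¹*y≈x k≉0 ⟩
    y               ∎

  *-nonzero : ∀ {x y} → NonZero x → NonZero y → NonZero (x * y)
  *-nonzero {x} {y} x≉0 y≉0 xy≈0 = x≉0 (*-cancelˡ y≉0 (begin
    y * x   ≈⟨ *-comm y x ⟩
    x * y   ≈⟨ xy≈0 ⟩
    0#      ≈⟨ sym (zeroʳ y) ⟩
    y * 0#  ∎))

  ^-nonzero : ∀ {x} → NonZero x → ∀ n → NonZero (x ^ n)
  ^-nonzero x≉0 zero = 1≉0
  ^-nonzero x≉0 (suc n) = *-nonzero (^-nonzero x≉0 n) x≉0

  ≉1-cong : ∀ {y y'} → y ≈ y' → ¬ (y' ≈ 1#) → ¬ (y ≈ 1#)
  ≉1-cong y≈y' y'≉1 y≈1 = y'≉1 (trans (sym y≈y') y≈1)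

  1-nonzero : ∀ {y} → ¬ (y ≈ 1#) → NonZero (1# - y)
  1-nonzero {y} y≉1 1-y≈0 = y≉1 (begin
    y              ≈⟨ solve 1 (λ y → y := :1 :- (:1 :- y)) refl y ⟩
    1# - (1# - y)  ≈⟨ +-congˡ (-‿cong 1-y≈0) ⟩
    1# - 0#        ≈⟨ solve 0 (:1 :- :0 := :1) refl ⟩
    1#             ∎)

  ⁻¹-unique : ∀ {x y} → NonZero x → x * y ≈ 1# → y ≈ x ⁻¹
  ⁻¹-unique x≉0 xy≈1 = *-cancelˡ x≉0 (trans xy≈1 (sym (x*x⁻¹≈1 x≉0)))

  ⁻¹-distrib-* : ∀ {x y} → NonZero x → NonZero y → (x * y) ⁻¹ ≈ x ⁻¹ * y ⁻¹
  ⁻¹-distrib-* {x} {y} x≉0 y≉0 = sym (⁻¹-unique (*-nonzero x≉0 y≉0) (begin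
    (x * y) * (x ⁻¹ * y ⁻¹)
      ≈⟨ solve 4 (λ x y x' y' → (x :* y) :* (x' :* y') := (x :* x') :* (y :* y')) refl x y (x ⁻¹) (y ⁻¹) ⟩
    (x * x ⁻¹) * (y * y ⁻¹)  ≈⟨ *-cong (x*x⁻¹≈1 x≉0) (x*x⁻¹≈1 y≉0) ⟩
    1# * 1#                  ≈⟨ *-identityˡ 1# ⟩
    1#                       ∎))

  ⁻¹-factor : ∀ {x y z} → NonZero x → NonZero z → x * y ≈ z → x ⁻¹ ≈ y * z ⁻¹
  ⁻¹-factor {x} {y} {z} x≉0 z≉0 xy≈z = sym (⁻¹-unique x≉0 (begin
    x * (y * z ⁻¹)  ≈⟨ sym (*-assoc _ _ _) ⟩
    (x * y) * z ⁻¹  ≈⟨ *-congʳ xy≈z ⟩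
    z * z ⁻¹        ≈⟨ x*x⁻¹≈1 z≉0 ⟩
    1#              ∎))

  x⁻¹^n*x^n≈1 : ∀ {x} → NonZero x → ∀ n → (x ⁻¹) ^ n * x ^ n ≈ 1#
  x⁻¹^n*x^n≈1 x≉0 zero = *-identityˡ 1#
  x⁻¹^n*x^n≈1 {x} x≉0 (suc n) = begin
    ((x ⁻¹) ^ n * x ⁻¹) * (x ^ n * x)
      ≈⟨ solve 4 (λ u v y z → (u :* y) :* (v :* z) := (u :* v) :* (y :* z))
           refl ((x ⁻¹) ^ n) (x ^ n) (x ⁻¹) x ⟩
    ((x ⁻¹) ^ n * x ^ n) * (x ⁻¹ * x)  ≈⟨ *-cong (x⁻¹^n*x^n≈1 x≉0 n) (x⁻¹*x≈1 x≉0) ⟩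
    1# * 1#                            ≈⟨ *-identityˡ 1# ⟩
    1#                                 ∎

  ^-+ : ∀ x m n → x ^ (m ℕ.+ n) ≈ x ^ m * x ^ n
  ^-+ x zero n = sym (*-identityˡ _)
  ^-+ x (suc m) n = begin
    x ^ (m ℕ.+ n) * x    ≈⟨ *-congʳ (^-+ x m n) ⟩
    (x ^ m * x ^ n) * x  ≈⟨ solve 3 (λ u v x → (u :* v) :* x := (u :* x) :* v) refl (x ^ m) (x ^ n) x ⟩
    (x ^ m * x) * x ^ n  ∎

  x≈y⇒x-y≈0 : ∀ {x y} → x ≈ y → x - y ≈ 0#
  x≈y⇒x-y≈0 {x} {y} x≈y = trans (+-congʳ x≈y) (-‿inverseʳ y)

  x-y≈0⇒x≈y : ∀ {x y} → x - y ≈ 0# → x ≈ y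
  x-y≈0⇒x≈y {x} {y} x-y≈0 = begin
    x            ≈⟨ solve 2 (λ x y → x := (x :- y) :+ y) refl x y ⟩
    (x - y) + y  ≈⟨ +-congʳ x-y≈0 ⟩
    0# + y       ≈⟨ +-identityˡ y ⟩
    y            ∎

  x+[u-v]*y≈x : ∀ {u v} → u ≈ v → ∀ y x → x + (u - v) * y ≈ x
  x+[u-v]*y≈x {u} {v} u≈v y x = begin
    x + (u - v) * y  ≈⟨ +-congˡ (*-congʳ (x≈y⇒x-y≈0 u≈v)) ⟩
    x + 0# * y       ≈⟨ +-congˡ (zeroˡ y) ⟩
    x + 0#           ≈⟨ +-identityʳ x ⟩
    x                ∎

  y≈0⇒x*y≈0 : ∀ {x y} → y ≈ 0# → x * y ≈ 0#
  y≈0⇒x*y≈0 {x} y≈0 = trans (*-congˡ y≈0) (zeroʳ x)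

module SumProperties {c ℓ : Level} (F : Field c ℓ) where

  open Field F hiding (zero)
  open AskeyWilson F using (sumTo)
  open FieldProperties F using (x≈y⇒x-y≈0)
  open IntegerCoefficientSolver commutativeRing using (solve; _:=_; _:+_; :-_)
  open import Relation.Binary.Reasoning.Setoid setoid

  sumTo-cong : ∀ {f g : ℕ → Carrier} n → (∀ k → f k ≈ g k) → sumTo f n ≈ sumTo g n
  sumTo-cong zero f≈g = f≈g zero
  sumTo-cong (suc n) f≈g = +-cong (sumTo-cong n f≈g) (f≈g (suc n))

  sumTo-distrib-+ : ∀ (f g : ℕ → Carrier) n → sumTo (λ k → f k + g k) n ≈ sumTo f n + sumTo g n
  sumTo-distrib-+ f g zero = refl
  sumTo-distrib-+ f g (suc n) = begin
    sumTo (λ k → f k + g k) n + (f (suc n) + g (suc n))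
      ≈⟨ +-congʳ (sumTo-distrib-+ f g n) ⟩
    (sumTo f n + sumTo g n) + (f (suc n) + g (suc n))
      ≈⟨ solve 4 (λ a b c d → (a :+ b) :+ (c :+ d) := (a :+ c) :+ (b :+ d))
           refl (sumTo f n) (sumTo g n) (f (suc n)) (g (suc n)) ⟩
    (sumTo f n + f (suc n)) + (sumTo g n + g (suc n)) ∎

  sumTo-*ˡ : ∀ (k : Carrier) (f : ℕ → Carrier) n → sumTo (λ j → k * f j) n ≈ k * sumTo f n
  sumTo-*ˡ k f zero = refl
  sumTo-*ˡ k f (suc n) = trans (+-congʳ (sumTo-*ˡ k f n)) (sym (distribˡ k _ _))

  sumTo-neg : ∀ (f : ℕ → Carrier) n → sumTo (λ j → - f j) n ≈ - sumTo f n
  sumTo-neg f zero = refl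
  sumTo-neg f (suc n) = begin
    sumTo (λ j → - f j) n + - f (suc n)
      ≈⟨ +-congʳ (sumTo-neg f n) ⟩
    - sumTo f n + - f (suc n)
      ≈⟨ solve 2 (λ a b → :- a :+ :- b := :- (a :+ b)) refl (sumTo f n) (f (suc n)) ⟩
    - (sumTo f n + f (suc n)) ∎

  sumTo-unconsˡ : ∀ (f : ℕ → Carrier) n → sumTo f (suc n) ≈ f zero + sumTo (λ k → f (suc k)) n
  sumTo-unconsˡ f zero = refl
  sumTo-unconsˡ f (suc n) = trans (+-congʳ (sumTo-unconsˡ f n)) (+-assoc _ _ _)

  sumTo-zero-lastʳ : ∀ (f : ℕ → Carrier) n → f (suc n) ≈ 0# → sumTo f (suc n) ≈ sumTo f n
  sumTo-zero-lastʳ f n fn≈0 = trans (+-congˡ fn≈0) (+-identityʳ _)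

  sumTo-suc-difference : ∀ (f g h : ℕ → Carrier) (t : Carrier) n → f 0 ≈ g 0 →
                         (∀ i → f (suc i) - g (suc i) ≈ t * h i) →
                         sumTo f (suc n) - sumTo g (suc n) ≈ t * sumTo h n
  sumTo-suc-difference f g h t n f₀≈g₀ f-g≈th = begin
    sumTo f (suc n) - sumTo g (suc n)
      ≈⟨ +-congˡ (sym (sumTo-neg g (suc n))) ⟩
    sumTo f (suc n) + sumTo (λ k → - g k) (suc n)
      ≈⟨ sym (sumTo-distrib-+ f (λ k → - g k) (suc n)) ⟩
    sumTo (λ k → f k - g k) (suc n)
      ≈⟨ sumTo-unconsˡ (λ k → f k - g k) n ⟩
    (f 0 - g 0) + sumTo (λ k → f (suc k) - g (suc k)) n
      ≈⟨ +-cong (x≈y⇒x-y≈0 f₀≈g₀) (sumTo-cong n f-g≈th) ⟩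
    0# + sumTo (λ k → t * h k) n
      ≈⟨ +-identityˡ _ ⟩
    sumTo (λ k → t * h k) n
      ≈⟨ sumTo-*ˡ t h n ⟩
    t * sumTo h n ∎

  sumTo-combination : ∀ (f g h : ℕ → Carrier) (α β γ : Carrier) n →
                      (∀ k → γ * f k ≈ β * g k - α * h k) →
                      γ * sumTo f n ≈ β * sumTo g n - α * sumTo h n
  sumTo-combination f g h α β γ n γf≈βg-αh = begin
    γ * sumTo f n
      ≈⟨ sym (sumTo-*ˡ γ f n) ⟩
    sumTo (λ k → γ * f k) n
      ≈⟨ sumTo-cong n γf≈βg-αh ⟩
    sumTo (λ k → β * g k + - (α * h k)) n
      ≈⟨ sumTo-distrib-+ _ _ n ⟩
    sumTo (λ k → β * g k) n + sumTo (λ k → - (α * h k)) n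
      ≈⟨ +-congˡ (sumTo-neg _ n) ⟩
    sumTo (λ k → β * g k) n - sumTo (λ k → α * h k) n
      ≈⟨ +-cong (sumTo-*ˡ β g n) (-‿cong (sumTo-*ˡ α h n)) ⟩
    β * sumTo g n - α * sumTo h n ∎

module PochhammerProperties {c ℓ : Level} (F : Field c ℓ) where

  open import Relation.Nullary using (¬_)
  open Field F hiding (zero)
  open AskeyWilson F
  open FieldProperties F
  open IntegerCoefficientSolver commutativeRing using (solve; _:=_; _:+_; _:*_; _:-_; :1)
  open import Relation.Binary.Reasoning.Setoid setoid

  poch-cong : ∀ {z z'} q k → z ≈ z' → poch z q k ≈ poch z' q k
  poch-cong q zero z≈z' = refl
  poch-cong q (suc k) z≈z' = *-cong (poch-cong q k z≈z') (+-congˡ (-‿cong (*-congʳ z≈z')))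

  poch-unconsˡ : ∀ {z z' q} k → z * q ≈ z' → poch z q (suc k) ≈ (1# - z) * poch z' q k
  poch-unconsˡ {z} {z'} {q} zero _ =
    solve 1 (λ z → :1 :* (:1 :- z :* :1) := (:1 :- z) :* :1) refl z
  poch-unconsˡ {z} {z'} {q} (suc k) zq≈z' = begin
    poch z q (suc k) * (1# - z * (q ^ k * q))
      ≈⟨ *-congʳ (poch-unconsˡ k zq≈z') ⟩
    ((1# - z) * poch z' q k) * (1# - z * (q ^ k * q))
      ≈⟨ *-congˡ (+-congˡ (-‿cong (trans (solve 3 (λ z u q → z :* (u :* q) := (z :* q) :* u) refl z (q ^ k) q)
                                         (*-congʳ zq≈z')))) ⟩
    ((1# - z) * poch z' q k) * (1# - z' * q ^ k)
      ≈⟨ *-assoc _ _ _ ⟩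
    (1# - z) * poch z' q (suc k) ∎

  poch-nonzero : ∀ {z q} k → (∀ j → ¬ (z * q ^ j ≈ 1#)) → NonZero (poch z q k)
  poch-nonzero zero _ = 1≉0
  poch-nonzero (suc k) zqʲ≉1 = *-nonzero (poch-nonzero k zqʲ≉1) (1-nonzero (zqʲ≉1 k))

  poch-q⁻ʳ-vanishes : ∀ {q} → NonZero q → ∀ r → poch ((q ⁻¹) ^ r) q (suc r) ≈ 0#
  poch-q⁻ʳ-vanishes q≉0 r = y≈0⇒x*y≈0 (x≈y⇒x-y≈0 (sym (x⁻¹^n*x^n≈1 q≉0 r)))

  θ-factor : Carrier → Carrier → Carrier → ℕ → Carrier
  θ-factor a q x k = (1# - two * a * x * q ^ k) + (a * a) * (q ^ k * q ^ k)

  pochθ-unconsˡ : ∀ a q x k → pochθ a q x (suc k) ≈ θ-factor a q x 0 * pochθ (a * q) q x k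
  pochθ-unconsˡ a q x zero = *-comm _ _
  pochθ-unconsˡ a q x (suc k) = begin
    pochθ a q x (suc k) * θ-factor a q x (suc k)
      ≈⟨ *-congʳ (pochθ-unconsˡ a q x k) ⟩
    (θ-factor a q x 0 * pochθ (a * q) q x k) * θ-factor a q x (suc k)
      ≈⟨ *-congˡ (solve 5 (λ t a x u q →
           (:1 :- t :* a :* x :* (u :* q)) :+ (a :* a) :* ((u :* q) :* (u :* q))
           := (:1 :- t :* (a :* q) :* x :* u) :+ ((a :* q) :* (a :* q)) :* (u :* u)) refl two a x (q ^ k) q) ⟩
    (θ-factor a q x 0 * pochθ (a * q) q x k) * θ-factor (a * q) q x k
      ≈⟨ *-assoc _ _ _ ⟩
    θ-factor a q x 0 * pochθ (a * q) q x (suc k) ∎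

module Contiguity {c ℓ : Level} (F : Field c ℓ) where

  open import Relation.Nullary using (¬_)
  open Field F hiding (zero)
  open AskeyWilson F
  open FieldProperties F
  open SumProperties F
  open PochhammerProperties F
  open IntegerCoefficientSolver commutativeRing using (solve; _:=_; _:+_; _:*_; _:-_; :-_; :0; :1)
  open import Relation.Binary.Reasoning.Setoid setoid

  denom : (a b c d q : Carrier) → ℕ → Carrier
  denom a b c d q k = poch q q k * poch (a * b) q k * poch (a * c) q k * poch (a * d) q k

  coeff : (Z W a b c d q : Carrier) → ℕ → Carrier
  coeff Z W a b c d q k = (poch Z q k * poch W q k) * denom a b c d q k ⁻¹ * q ^ k

  -- The k-th summand of the sum in p n x a b c d q, for Z = q⁻ⁿ and W = abcd qⁿ⁻¹.
  term : (Z W a b c d q x : Carrier) → ℕ → Carrier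
  term Z W a b c d q x k = (poch Z q k * poch W q k * pochθ a q x k) * denom a b c d q k ⁻¹ * q ^ k

  term≈coeff*pochθ : ∀ Z W a b c d q x k → term Z W a b c d q x k ≈ coeff Z W a b c d q k * pochθ a q x k
  term≈coeff*pochθ Z W a b c d q x k =
    solve 5 (λ u v t i r → (u :* v :* t) :* i :* r := ((u :* v) :* i :* r) :* t)
      refl (poch Z q k) (poch W q k) (pochθ a q x k) (denom a b c d q k ⁻¹) (q ^ k)

  term-vanishes : ∀ {Z} W a b c d q x k → poch Z q k ≈ 0# → term Z W a b c d q x k ≈ 0#
  term-vanishes {Z} W a b c d q x k pochZ≈0 = begin
    (poch Z q k * poch W q k * T) * D⁻¹ * q ^ k
      ≈⟨ *-congʳ (*-congʳ (*-congʳ (*-congʳ pochZ≈0))) ⟩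
    (0# * poch W q k * T) * D⁻¹ * q ^ k
      ≈⟨ solve 4 (λ w t d r → (:0 :* w :* t) :* d :* r := :0) refl (poch W q k) T D⁻¹ (q ^ k) ⟩
    0# ∎
    where
    D⁻¹ = denom a b c d q k ⁻¹
    T = pochθ a q x k

  term-difference : ∀ {Z Z' W W' a b b' c d q t g} x i →
    coeff Z W a b c d q (suc i) - coeff Z' W' a b' c d q (suc i) ≈ t * g →
    term Z W a b c d q x (suc i) - term Z' W' a b' c d q x (suc i) ≈
    t * (θ-factor a q x 0 * (g * pochθ (a * q) q x i))
  term-difference {Z} {Z'} {W} {W'} {a} {b} {b'} {c} {d} {q} {t} {g} x i coeff-difference = begin
    term Z W a b c d q x (suc i) - term Z' W' a b' c d q x (suc i)
      ≈⟨ +-cong (term≈coeff*pochθ Z W a b c d q x (suc i)) (-‿cong (term≈coeff*pochθ Z' W' a b' c d q x (suc i))) ⟩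
    C * T - C' * T
      ≈⟨ solve 3 (λ C C' T → C :* T :- C' :* T := (C :- C') :* T) refl C C' T ⟩
    (C - C') * T
      ≈⟨ *-cong coeff-difference (pochθ-unconsˡ a q x i) ⟩
    (t * g) * (u * T')
      ≈⟨ solve 4 (λ t g u T' → (t :* g) :* (u :* T') := t :* (u :* (g :* T'))) refl t g u T' ⟩
    t * (u * (g * T')) ∎
    where
    C = coeff Z W a b c d q (suc i)
    C' = coeff Z' W' a b' c d q (suc i)
    T = pochθ a q x (suc i)
    T' = pochθ (a * q) q x i
    u = θ-factor a q x 0

  term-combination : ∀ {Z₁ Z₂ Z₃ W₁ W₂ W₃ a b₁ b₂ b₃ c d q α β γ} x k →
    γ * coeff Z₁ W₁ a b₁ c d q k ≈ β * coeff Z₂ W₂ a b₂ c d q k - α * coeff Z₃ W₃ a b₃ c d q k →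
    γ * term Z₁ W₁ a b₁ c d q x k ≈ β * term Z₂ W₂ a b₂ c d q x k - α * term Z₃ W₃ a b₃ c d q x k
  term-combination {Z₁} {Z₂} {Z₃} {W₁} {W₂} {W₃} {a} {b₁} {b₂} {b₃} {c} {d} {q} {α} {β} {γ} x k
                   γC₁≈βC₂-αC₃ = begin
    γ * term Z₁ W₁ a b₁ c d q x k
      ≈⟨ *-congˡ (term≈coeff*pochθ Z₁ W₁ a b₁ c d q x k) ⟩
    γ * (C₁ * T)
      ≈⟨ sym (*-assoc γ C₁ T) ⟩
    (γ * C₁) * T
      ≈⟨ *-congʳ γC₁≈βC₂-αC₃ ⟩
    (β * C₂ - α * C₃) * T
      ≈⟨ solve 5 (λ β C₂ α C₃ T → (β :* C₂ :- α :* C₃) :* T := β :* (C₂ :* T) :- α :* (C₃ :* T))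
           refl β C₂ α C₃ T ⟩
    β * (C₂ * T) - α * (C₃ * T)
      ≈⟨ sym (+-cong (*-congˡ (term≈coeff*pochθ Z₂ W₂ a b₂ c d q x k))
                     (-‿cong (*-congˡ (term≈coeff*pochθ Z₃ W₃ a b₃ c d q x k)))) ⟩
    β * term Z₂ W₂ a b₂ c d q x k - α * term Z₃ W₃ a b₃ c d q x k ∎
    where
    C₁ = coeff Z₁ W₁ a b₁ c d q k
    C₂ = coeff Z₂ W₂ a b₂ c d q k
    C₃ = coeff Z₃ W₃ a b₃ c d q k
    T = pochθ a q x k

  -- The case n = m + 2; S[x,y]ₖ below is the sum Sₘ₊ₖ(x, y) of the header.
  module Degree (q a b c d x : Carrier) (q≉0 : NonZero q) (a≉0 : NonZero a)
                (qʲ⁺¹≉1 : ∀ j → ¬ (q ^ suc j ≈ 1#))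
                (abqʲ≉1 : ∀ j → ¬ (a * b * q ^ j ≈ 1#))
                (acqʲ≉1 : ∀ j → ¬ (a * c * q ^ j ≈ 1#))
                (adqʲ≉1 : ∀ j → ¬ (a * d * q ^ j ≈ 1#))
                (m : ℕ) where

    qqʲ≉1 : ∀ j → ¬ (q * q ^ j ≈ 1#)
    qqʲ≉1 j = ≉1-cong (*-comm q (q ^ j)) (qʲ⁺¹≉1 j)

    1-qqⁱ≉0 : ∀ i → NonZero (1# - q * q ^ i)
    1-qqⁱ≉0 i = 1-nonzero (qqʲ≉1 i)

    shiftˡ : ∀ {u v} → (∀ j → ¬ (u * v * q ^ j ≈ 1#)) → ∀ j → ¬ ((u * q) * v * q ^ j ≈ 1#)
    shiftˡ {u} {v} uvqʲ≉1 j = ≉1-cong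
      (solve 4 (λ u v q qʲ → (u :* q) :* v :* qʲ := u :* v :* (qʲ :* q)) refl u v q (q ^ j)) (uvqʲ≉1 (suc j))

    shiftʳ : ∀ {u v} → (∀ j → ¬ (u * v * q ^ j ≈ 1#)) → ∀ j → ¬ (u * (v * q) * q ^ j ≈ 1#)
    shiftʳ {u} {v} uvqʲ≉1 j = ≉1-cong
      (solve 4 (λ u v q qʲ → u :* (v :* q) :* qʲ := u :* v :* (qʲ :* q)) refl u v q (q ^ j)) (uvqʲ≉1 (suc j))

    1-y≉0 : ∀ {y} → (∀ j → ¬ (y * q ^ j ≈ 1#)) → NonZero (1# - y)
    1-y≉0 {y} yqʲ≉1 = 1-nonzero (≉1-cong (sym (*-identityʳ y)) (yqʲ≉1 0))

    denom≉0 : ∀ {a' b'} → (∀ j → ¬ (a' * b' * q ^ j ≈ 1#)) → (∀ j → ¬ (a' * c * q ^ j ≈ 1#)) →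
              (∀ j → ¬ (a' * d * q ^ j ≈ 1#)) → ∀ k → NonZero (denom a' b' c d q k)
    denom≉0 a'b'qʲ≉1 a'cqʲ≉1 a'dqʲ≉1 k =
      *-nonzero (*-nonzero (*-nonzero (poch-nonzero k qqʲ≉1) (poch-nonzero k a'b'qʲ≉1))
                           (poch-nonzero k a'cqʲ≉1))
                (poch-nonzero k a'dqʲ≉1)

    denom[a,b]≉0 : ∀ k → NonZero (denom a b c d q k)
    denom[a,b]≉0 = denom≉0 abqʲ≉1 acqʲ≉1 adqʲ≉1

    denom[a,bq]≉0 : ∀ k → NonZero (denom a (b * q) c d q k)
    denom[a,bq]≉0 = denom≉0 (shiftʳ abqʲ≉1) acqʲ≉1 adqʲ≉1

    denom[aq,b]≉0 : ∀ k → NonZero (denom (a * q) b c d q k)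
    denom[aq,b]≉0 = denom≉0 (shiftˡ abqʲ≉1) (shiftˡ acqʲ≉1) (shiftˡ adqʲ≉1)

    denom[aq,bq]≉0 : ∀ k → NonZero (denom (a * q) (b * q) c d q k)
    denom[aq,bq]≉0 = denom≉0 (shiftˡ (shiftʳ abqʲ≉1)) (shiftˡ acqʲ≉1) (shiftˡ adqʲ≉1)

    D₀ D₁ : Carrier
    D₀ = (1# - a * b) * (1# - a * b * q) * (1# - a * c) * (1# - a * d)
    D₁ = (1# - a * (b * q)) * (1# - a * c) * (1# - a * d)

    D₀≉0 : NonZero D₀
    D₀≉0 = *-nonzero (*-nonzero (*-nonzero (1-y≉0 abqʲ≉1) 1-abq≉0) (1-y≉0 acqʲ≉1)) (1-y≉0 adqʲ≉1)
      where
      1-abq≉0 : NonZero (1# - a * b * q)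
      1-abq≉0 = 1-nonzero (≉1-cong (*-congˡ (sym (*-identityˡ q))) (abqʲ≉1 1))

    poch[ay]-unconsˡ : ∀ y i → poch (a * y) q (suc i) ≈ (1# - a * y) * poch ((a * q) * y) q i
    poch[ay]-unconsˡ y i = poch-unconsˡ i (solve 3 (λ a y q → a :* y :* q := (a :* q) :* y) refl a y q)

    poch[ab]-unconsˡ² : ∀ i → poch (a * b) q (suc i) * (1# - a * b * q * q ^ i) ≈
                              (1# - a * b) * ((1# - a * b * q) * poch ((a * q) * (b * q)) q i)
    poch[ab]-unconsˡ² i = begin
      poch (a * b) q (suc i) * (1# - a * b * q * q ^ i)
        ≈⟨ *-congʳ (poch-unconsˡ i refl) ⟩
      ((1# - a * b) * poch (a * b * q) q i) * (1# - a * b * q * q ^ i)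
        ≈⟨ *-assoc _ _ _ ⟩
      (1# - a * b) * poch (a * b * q) q (suc i)
        ≈⟨ *-congˡ (poch-unconsˡ i (solve 3 (λ a b q → a :* b :* q :* q := (a :* q) :* (b :* q)) refl a b q)) ⟩
      (1# - a * b) * ((1# - a * b * q) * poch ((a * q) * (b * q)) q i) ∎

    denom[a,b]-unconsˡ : ∀ i → denom a b c d q (suc i) * (1# - a * b * q * q ^ i) ≈
                               denom (a * q) (b * q) c d q i * ((1# - q * q ^ i) * D₀)
    denom[a,b]-unconsˡ i = begin
      Q * K * P[ab] * P[ac] * P[ad] * (1# - a * b * q * q ^ i)
        ≈⟨ solve 6 (λ Q K P P' P'' Y → Q :* K :* P :* P' :* P'' :* Y := Q :* K :* (P :* Y) :* P' :* P'')
             refl Q K P[ab] P[ac] P[ad] (1# - a * b * q * q ^ i) ⟩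
      Q * K * (P[ab] * (1# - a * b * q * q ^ i)) * P[ac] * P[ad]
        ≈⟨ *-cong (*-cong (*-congˡ (poch[ab]-unconsˡ² i)) (poch[ay]-unconsˡ c i)) (poch[ay]-unconsˡ d i) ⟩
      Q * K * (Lab * (Labq * G[ab])) * (Lac * G[ac]) * (Lad * G[ad])
        ≈⟨ solve 9 (λ Q K Lab Labq Lac Lad G G' G'' →
                      Q :* K :* (Lab :* (Labq :* G)) :* (Lac :* G') :* (Lad :* G'')
                      := Q :* G :* G' :* G'' :* (K :* (Lab :* Labq :* Lac :* Lad)))
             refl Q K Lab Labq Lac Lad G[ab] G[ac] G[ad] ⟩
      denom (a * q) (b * q) c d q i * (K * D₀) ∎
      where
      Q = poch q q i
      K = 1# - q * q ^ i
      P[ab] = poch (a * b) q (suc i)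
      P[ac] = poch (a * c) q (suc i)
      P[ad] = poch (a * d) q (suc i)
      G[ab] = poch ((a * q) * (b * q)) q i
      G[ac] = poch ((a * q) * c) q i
      G[ad] = poch ((a * q) * d) q i
      Lab = 1# - a * b
      Labq = 1# - a * b * q
      Lac = 1# - a * c
      Lad = 1# - a * d

    denom[a,bq]-unconsˡ : ∀ i → denom a (b * q) c d q (suc i) ≈
                                denom (a * q) (b * q) c d q i * ((1# - q * q ^ i) * D₁)
    denom[a,bq]-unconsˡ i = begin
      denom a (b * q) c d q (suc i)
        ≈⟨ *-cong (*-cong (*-congˡ (poch[ay]-unconsˡ (b * q) i)) (poch[ay]-unconsˡ c i)) (poch[ay]-unconsˡ d i) ⟩
      Q * K * (Labq * G[ab]) * (Lac * G[ac]) * (Lad * G[ad])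
        ≈⟨ solve 8 (λ Q K Labq Lac Lad G G' G'' →
                     Q :* K :* (Labq :* G) :* (Lac :* G') :* (Lad :* G'')
                     := Q :* G :* G' :* G'' :* (K :* (Labq :* Lac :* Lad)))
             refl Q K Labq Lac Lad G[ab] G[ac] G[ad] ⟩
      denom (a * q) (b * q) c d q i * (K * D₁) ∎
      where
      Q = poch q q i
      K = 1# - q * q ^ i
      G[ab] = poch ((a * q) * (b * q)) q i
      G[ac] = poch ((a * q) * c) q i
      G[ad] = poch ((a * q) * d) q i
      Labq = 1# - a * (b * q)
      Lac = 1# - a * c
      Lad = 1# - a * d

    denom[a,b]⁻¹-unconsˡ : ∀ i → denom a b c d q (suc i) ⁻¹ ≈
                                 (1# - a * b * q * q ^ i) *
                                 (denom (a * q) (b * q) c d q i ⁻¹ * ((1# - q * q ^ i) ⁻¹ * D₀ ⁻¹))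
    denom[a,b]⁻¹-unconsˡ i = begin
      denom a b c d q (suc i) ⁻¹
        ≈⟨ ⁻¹-factor (denom[a,b]≉0 (suc i)) (*-nonzero G≉0 KD₀≉0) (denom[a,b]-unconsˡ i) ⟩
      (1# - a * b * q * q ^ i) * (G * (K * D₀)) ⁻¹
        ≈⟨ *-congˡ (trans (⁻¹-distrib-* G≉0 KD₀≉0) (*-congˡ (⁻¹-distrib-* (1-qqⁱ≉0 i) D₀≉0))) ⟩
      (1# - a * b * q * q ^ i) * (G ⁻¹ * (K ⁻¹ * D₀ ⁻¹)) ∎
      where
      G = denom (a * q) (b * q) c d q i
      K = 1# - q * q ^ i
      G≉0 = denom[aq,bq]≉0 i
      KD₀≉0 = *-nonzero (1-qqⁱ≉0 i) D₀≉0

    denom[a,bq]⁻¹-unconsˡ : ∀ i → denom a (b * q) c d q (suc i) ⁻¹ ≈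
                                  denom (a * q) (b * q) c d q i ⁻¹ *
                                  ((1# - a * b) * ((1# - q * q ^ i) ⁻¹ * D₀ ⁻¹))
    denom[a,bq]⁻¹-unconsˡ i = sym (⁻¹-unique (denom[a,bq]≉0 (suc i)) (begin
      denom a (b * q) c d q (suc i) * (G ⁻¹ * ((1# - a * b) * (K ⁻¹ * D₀ ⁻¹)))
        ≈⟨ *-congʳ (denom[a,bq]-unconsˡ i) ⟩
      G * (K * D₁) * (G ⁻¹ * ((1# - a * b) * (K ⁻¹ * D₀ ⁻¹)))
        ≈⟨ solve 10 (λ G G⁻¹ K K⁻¹ D₀⁻¹ a b c d q →
                      G :* (K :* ((:1 :- a :* (b :* q)) :* (:1 :- a :* c) :* (:1 :- a :* d)))
                        :* (G⁻¹ :* ((:1 :- a :* b) :* (K⁻¹ :* D₀⁻¹)))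
                      := G :* G⁻¹ :* (K :* K⁻¹ :* ((:1 :- a :* b) :* (:1 :- a :* b :* q) :* (:1 :- a :* c)
                                                  :* (:1 :- a :* d) :* D₀⁻¹)))
             refl G (G ⁻¹) K (K ⁻¹) (D₀ ⁻¹) a b c d q ⟩
      (G * G ⁻¹) * ((K * K ⁻¹) * (D₀ * D₀ ⁻¹))
        ≈⟨ *-cong (x*x⁻¹≈1 (denom[aq,bq]≉0 i)) (*-cong (x*x⁻¹≈1 (1-qqⁱ≉0 i)) (x*x⁻¹≈1 D₀≉0)) ⟩
      1# * (1# * 1#)
        ≈⟨ trans (*-identityˡ _) (*-identityˡ _) ⟩
      1# ∎))
      where
      G = denom (a * q) (b * q) c d q i
      K = 1# - q * q ^ i

    1-[aq]b≉0 : NonZero (1# - (a * q) * b)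
    1-[aq]b≉0 = 1-y≉0 (shiftˡ abqʲ≉1)

    poch-[aq]b-to-[aq][bq] : ∀ i → poch ((a * q) * b) q (suc i) * (1# - (a * q) * (b * q) * q ^ i) ≈
                                   (1# - (a * q) * b) * poch ((a * q) * (b * q)) q (suc i)
    poch-[aq]b-to-[aq][bq] i = begin
      poch ((a * q) * b) q (suc i) * (1# - (a * q) * (b * q) * q ^ i)
        ≈⟨ *-congʳ (poch-unconsˡ i [aq]bq≈[aq][bq]) ⟩
      ((1# - (a * q) * b) * poch ((a * q) * (b * q)) q i) * (1# - (a * q) * (b * q) * q ^ i)
        ≈⟨ *-assoc _ _ _ ⟩
      (1# - (a * q) * b) * poch ((a * q) * (b * q)) q (suc i) ∎
      where
      [aq]bq≈[aq][bq] = solve 3 (λ a b q → (a :* q) :* b :* q := (a :* q) :* (b :* q)) refl a b q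

    denom-[aq,b]-to-[aq,bq] : ∀ i → denom (a * q) b c d q (suc i) * (1# - (a * q) * (b * q) * q ^ i) ≈
                                    denom (a * q) (b * q) c d q (suc i) * (1# - (a * q) * b)
    denom-[aq,b]-to-[aq,bq] i = begin
      Q * P * C * D * (1# - (a * q) * (b * q) * q ^ i)
        ≈⟨ solve 5 (λ Q P C D Y → Q :* P :* C :* D :* Y := Q :* (P :* Y) :* C :* D)
             refl Q P C D (1# - (a * q) * (b * q) * q ^ i) ⟩
      Q * (P * (1# - (a * q) * (b * q) * q ^ i)) * C * D
        ≈⟨ *-congʳ (*-congʳ (*-congˡ (poch-[aq]b-to-[aq][bq] i))) ⟩
      Q * ((1# - (a * q) * b) * P') * C * D
        ≈⟨ solve 5 (λ Q P' C D Y → Q :* (Y :* P') :* C :* D := Q :* P' :* C :* D :* Y)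
             refl Q P' C D (1# - (a * q) * b) ⟩
      Q * P' * C * D * (1# - (a * q) * b) ∎
      where
      Q = poch q q (suc i)
      P = poch ((a * q) * b) q (suc i)
      P' = poch ((a * q) * (b * q)) q (suc i)
      C = poch ((a * q) * c) q (suc i)
      D = poch ((a * q) * d) q (suc i)

    denom-[aq,b]⁻¹-to-[aq,bq] : ∀ i → denom (a * q) b c d q (suc i) ⁻¹ ≈
                                      (1# - (a * q) * (b * q) * q ^ i) *
                                      (denom (a * q) (b * q) c d q (suc i) ⁻¹ * (1# - (a * q) * b) ⁻¹)
    denom-[aq,b]⁻¹-to-[aq,bq] i =
      trans (⁻¹-factor (denom[aq,b]≉0 (suc i)) G*L≉0 (denom-[aq,b]-to-[aq,bq] i))
            (*-congˡ (⁻¹-distrib-* (denom[aq,bq]≉0 (suc i)) 1-[aq]b≉0))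
      where
      G*L≉0 = *-nonzero (denom[aq,bq]≉0 (suc i)) 1-[aq]b≉0

    z₀ z₁ z₂ : Carrier
    z₀ = (q ⁻¹) ^ m
    z₁ = (q ⁻¹) ^ suc m
    z₂ = (q ⁻¹) ^ suc (suc m)

    z₁q≈z₀ : z₁ * q ≈ z₀
    z₁q≈z₀ = x*y⁻¹*y≈x q≉0

    z₂q≈z₁ : z₂ * q ≈ z₁
    z₂q≈z₁ = x*y⁻¹*y≈x q≉0

    z₀qᵐ≈1 : z₀ * q ^ m ≈ 1#
    z₀qᵐ≈1 = x⁻¹^n*x^n≈1 q≉0 m

    z₁qqᵐ≈1 : z₁ * q * q ^ m ≈ 1#
    z₁qqᵐ≈1 = trans (*-congʳ z₁q≈z₀) z₀qᵐ≈1

    w : ℕ → Carrier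
    w k = a * b * c * d * q ^ k

    w[a,bq] w[aq,b] w[aq,bq] : Carrier
    w[a,bq] = a * (b * q) * c * d * q ^ m
    w[aq,b] = (a * q) * b * c * d * q ^ m
    w[aq,bq] = (a * q) * (b * q) * c * d * q ^ m

    w[a,bq]≈w[m+1] : w[a,bq] ≈ w (suc m)
    w[a,bq]≈w[m+1] =
      solve 6 (λ a b c d q qᵐ → a :* (b :* q) :* c :* d :* qᵐ := a :* b :* c :* d :* (qᵐ :* q))
        refl a b c d q (q ^ m)

    w[m+1]q≈w[aq,bq] : w (suc m) * q ≈ w[aq,bq]
    w[m+1]q≈w[aq,bq] =
      solve 6 (λ a b c d q qᵐ → a :* b :* c :* d :* (qᵐ :* q) :* q := (a :* q) :* (b :* q) :* c :* d :* qᵐ)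
        refl a b c d q (q ^ m)

    w[a,bq]q≈w[aq,bq] : w[a,bq] * q ≈ w[aq,bq]
    w[a,bq]q≈w[aq,bq] =
      solve 6 (λ a b c d q qᵐ → a :* (b :* q) :* c :* d :* qᵐ :* q := (a :* q) :* (b :* q) :* c :* d :* qᵐ)
        refl a b c d q (q ^ m)

    w[aq,b]q≈w[m+2] : w[aq,b] * q ≈ w (suc (suc m))
    w[aq,b]q≈w[m+2] =
      solve 6 (λ a b c d q qᵐ → (a :* q) :* b :* c :* d :* qᵐ :* q := a :* b :* c :* d :* ((qᵐ :* q) :* q))
        refl a b c d q (q ^ m)

    w[aq,bq]≈w[m+2] : w[aq,bq] ≈ w (suc (suc m))
    w[aq,bq]≈w[m+2] =
      solve 6 (λ a b c d q qᵐ → (a :* q) :* (b :* q) :* c :* d :* qᵐ := a :* b :* c :* d :* ((qᵐ :* q) :* q))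
        refl a b c d q (q ^ m)

    τ₁ τ₂ α β γ : Carrier
    τ₁ = (q * (1# - z₁)) * (a * b * (1# - c * d * q ^ m)) * D₀ ⁻¹
    τ₂ = (1# - w (suc m)) * q * (a * b - z₂) * D₀ ⁻¹
    α = q * a * b * (1# - q ^ suc m) * (1# - c * d * q ^ m)
    β = (1# - w (suc m)) * (1# - a * b * q ^ suc (suc m))
    γ = (1# - a * b * c * d * (q ^ suc m * q ^ suc m)) * (1# - (a * q) * b)

    -- The solver proves each relation only up to multiples of u - v for equations u ≈ v it
    -- cannot see (z₀ qᵐ ≈ 1, (1 - q qⁱ)⁻¹ (1 - q qⁱ) ≈ 1, ...); the steps x+[u-v]*y≈x discard them.
    relation-I : ∀ i → coeff z₁ (w m) a b c d q (suc i) - coeff z₁ w[a,bq] a (b * q) c d q (suc i) ≈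
                       τ₁ * coeff z₀ (w (suc m)) (a * q) (b * q) c d q i
    relation-I i = begin
      coeff z₁ (w m) a b c d q (suc i) - coeff z₁ w[a,bq] a (b * q) c d q (suc i)
        ≈⟨ +-cong (*-congʳ (*-cong (*-cong (poch-unconsˡ i z₁q≈z₀) (poch-unconsˡ i (*-assoc _ _ _)))
                                   (denom[a,b]⁻¹-unconsˡ i)))
                  (-‿cong (*-congʳ (*-cong (*-cong (poch-unconsˡ i z₁q≈z₀) (poch-cong q (suc i) w[a,bq]≈w[m+1]))
                                           (denom[a,bq]⁻¹-unconsˡ i)))) ⟩
      _ ≈⟨ solve 13 (λ z₁ A B G⁻¹ K⁻¹ D₀⁻¹ qⁱ q a b c d qᵐ →
                      (:1 :- z₁) :* A :* ((:1 :- a :* b :* c :* d :* qᵐ) :* B)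
                      :* ((:1 :- a :* b :* q :* qⁱ) :* (G⁻¹ :* (K⁻¹ :* D₀⁻¹))) :* (qⁱ :* q)
                      :- (:1 :- z₁) :* A :* (B :* (:1 :- a :* b :* c :* d :* (qᵐ :* q) :* qⁱ))
                         :* (G⁻¹ :* ((:1 :- a :* b) :* (K⁻¹ :* D₀⁻¹))) :* (qⁱ :* q)
                      := q :* (:1 :- z₁) :* (a :* b :* (:1 :- c :* d :* qᵐ)) :* D₀⁻¹ :* (A :* B :* G⁻¹ :* qⁱ)
                         :+ (K⁻¹ :* (:1 :- q :* qⁱ) :- :1)
                            :* (A :* B :* G⁻¹ :* qⁱ :* q :* (:1 :- z₁) :* D₀⁻¹
                                :* (a :* b :* (:1 :- c :* d :* qᵐ))))
            refl z₁ (poch z₀ q i) (poch (w (suc m)) q i) (denom (a * q) (b * q) c d q i ⁻¹)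
            ((1# - q * q ^ i) ⁻¹) (D₀ ⁻¹) (q ^ i) q a b c d (q ^ m) ⟩
      _ ≈⟨ x+[u-v]*y≈x (x⁻¹*x≈1 (1-qqⁱ≉0 i)) _ _ ⟩
      τ₁ * coeff z₀ (w (suc m)) (a * q) (b * q) c d q i ∎

    relation-II : ∀ i → coeff z₂ (w (suc m)) a b c d q (suc i) - coeff z₁ w[a,bq] a (b * q) c d q (suc i) ≈
                        τ₂ * coeff z₁ w[aq,bq] (a * q) (b * q) c d q i
    relation-II i = begin
      coeff z₂ (w (suc m)) a b c d q (suc i) - coeff z₁ w[a,bq] a (b * q) c d q (suc i)
        ≈⟨ +-cong (*-congʳ (*-cong (*-cong (poch-unconsˡ i z₂q≈z₁) (poch-unconsˡ i w[m+1]q≈w[aq,bq]))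
                                   (denom[a,b]⁻¹-unconsˡ i)))
                  (-‿cong (*-congʳ (*-cong (*-congˡ (poch-unconsˡ i w[a,bq]q≈w[aq,bq]))
                                           (denom[a,bq]⁻¹-unconsˡ i)))) ⟩
      _ ≈⟨ solve 14 (λ z₁ z₂ A B G⁻¹ K⁻¹ D₀⁻¹ qⁱ q a b c d qᵐ →
                      (:1 :- z₂) :* A :* ((:1 :- a :* b :* c :* d :* (qᵐ :* q)) :* B)
                      :* ((:1 :- a :* b :* q :* qⁱ) :* (G⁻¹ :* (K⁻¹ :* D₀⁻¹))) :* (qⁱ :* q)
                      :- A :* (:1 :- z₁ :* qⁱ) :* ((:1 :- a :* (b :* q) :* c :* d :* qᵐ) :* B)
                         :* (G⁻¹ :* ((:1 :- a :* b) :* (K⁻¹ :* D₀⁻¹))) :* (qⁱ :* q)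
                      := (:1 :- a :* b :* c :* d :* (qᵐ :* q)) :* q :* (a :* b :- z₂) :* D₀⁻¹
                         :* (A :* B :* G⁻¹ :* qⁱ)
                         :+ (K⁻¹ :* (:1 :- q :* qⁱ) :- :1)
                            :* (A :* B :* G⁻¹ :* qⁱ :* q :* D₀⁻¹ :* (:1 :- a :* b :* c :* d :* (qᵐ :* q))
                                :* (a :* b :- z₂))
                         :+ (z₂ :* q :- z₁)
                            :* :- (A :* B :* G⁻¹ :* qⁱ :* q :* D₀⁻¹ :* (:1 :- a :* b :* c :* d :* (qᵐ :* q))
                                :* K⁻¹ :* qⁱ :* (:1 :- a :* b)))
            refl z₁ z₂ (poch z₁ q i) (poch w[aq,bq] q i) (denom (a * q) (b * q) c d q i ⁻¹)
            ((1# - q * q ^ i) ⁻¹) (D₀ ⁻¹) (q ^ i) q a b c d (q ^ m) ⟩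
      _ ≈⟨ x+[u-v]*y≈x z₂q≈z₁ _ _ ⟩
      _ ≈⟨ x+[u-v]*y≈x (x⁻¹*x≈1 (1-qqⁱ≉0 i)) _ _ ⟩
      τ₂ * coeff z₁ w[aq,bq] (a * q) (b * q) c d q i ∎

    relation-III : ∀ k → γ * coeff z₁ w[aq,b] (a * q) b c d q k ≈
                         β * coeff z₁ w[aq,bq] (a * q) (b * q) c d q k
                         - α * coeff z₀ (w (suc m)) (a * q) (b * q) c d q k
    relation-III zero = solve 7 (λ C q a b c d qᵐ →
                  (:1 :- a :* b :* c :* d :* (qᵐ :* q :* (qᵐ :* q))) :* (:1 :- a :* q :* b) :* C
                  := (:1 :- a :* b :* c :* d :* (qᵐ :* q)) :* (:1 :- a :* b :* (qᵐ :* q :* q)) :* C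
                     :- q :* a :* b :* (:1 :- qᵐ :* q) :* (:1 :- c :* d :* qᵐ) :* C)
          refl (coeff z₁ w[aq,b] (a * q) b c d q 0) q a b c d (q ^ m)
    relation-III (suc i) = *-cancelˡ (*-nonzero q≉0 (^-nonzero q≉0 m)) (begin
      (q * q ^ m) * (γ * coeff z₁ w[aq,b] (a * q) b c d q (suc i))
        ≈⟨ *-congˡ (*-congˡ (*-congʳ (*-cong (*-cong (poch-unconsˡ i z₁q≈z₀) (poch-unconsˡ i w[aq,b]q≈w[m+2]))
                                              (denom-[aq,b]⁻¹-to-[aq,bq] i)))) ⟩
      _ ≈⟨ solve 13 (λ z₀ z₁ A B G⁻¹ L⁻¹ qⁱ q a b c d qᵐ →
                      q :* qᵐ
                      :* ((:1 :- a :* b :* c :* d :* (qᵐ :* q :* (qᵐ :* q))) :* (:1 :- a :* q :* b)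
                          :* ((:1 :- z₁) :* A :* ((:1 :- a :* q :* b :* c :* d :* qᵐ) :* B)
                              :* ((:1 :- a :* q :* (b :* q) :* qⁱ) :* (G⁻¹ :* L⁻¹)) :* (qⁱ :* q)))
                      := q :* qᵐ
                         :* ((:1 :- a :* b :* c :* d :* (qᵐ :* q)) :* (:1 :- a :* b :* (qᵐ :* q :* q))
                             :* ((:1 :- z₁) :* A :* (B :* (:1 :- a :* b :* c :* d :* (qᵐ :* q :* q) :* qⁱ))
                                 :* G⁻¹ :* (qⁱ :* q))
                             :- q :* a :* b :* (:1 :- qᵐ :* q) :* (:1 :- c :* d :* qᵐ)
                                :* (A :* (:1 :- z₀ :* qⁱ) :* ((:1 :- a :* b :* c :* d :* (qᵐ :* q)) :* B)
                                    :* G⁻¹ :* (qⁱ :* q)))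
                         :+ ((:1 :- a :* q :* b) :* L⁻¹ :- :1)
                            :* (q :* qᵐ :* (A :* B :* G⁻¹ :* qⁱ :* q)
                                :* (:1 :- a :* b :* c :* d :* (qᵐ :* q :* (qᵐ :* q))) :* (:1 :- z₁)
                                :* (:1 :- a :* q :* b :* c :* d :* qᵐ) :* (:1 :- a :* q :* (b :* q) :* qⁱ))
                         :+ (z₁ :* q :* qᵐ :- :1)
                            :* (A :* B :* G⁻¹ :* qⁱ :* q
                                :* (qⁱ :* a :* b :* q :* q
                                    :+ :- :1 :* qⁱ :* qᵐ :* a :* a :* b :* b :* c :* d :* q :* q :* q
                                    :+ qᵐ :* qᵐ :* a :* b :* c :* d :* q :* q
                                    :+ :- :1 :* qᵐ :* qᵐ :* qᵐ :* a :* a :* b :* b :* c :* c :* d :* d :* q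
                                       :* q :* q
                                    :+ :- :1 :* qⁱ :* qᵐ :* a :* b :* c :* d :* q :* q
                                    :+ :- :1 :* qᵐ :* a :* b :* q :* q
                                    :+ qⁱ :* qᵐ :* qᵐ :* a :* a :* b :* b :* c :* c :* d :* d :* q :* q :* q
                                    :+ qᵐ :* qᵐ :* a :* a :* b :* b :* c :* d :* q :* q :* q))
                         :+ (z₀ :* qᵐ :- :1)
                            :* (A :* B :* G⁻¹ :* qⁱ :* q :* q
                                :* (:- :1 :* qⁱ :* a :* b :* q
                                    :+ qⁱ :* qᵐ :* a :* a :* b :* b :* c :* d :* q :* q
                                    :+ qⁱ :* qᵐ :* a :* b :* c :* d :* q
                                    :+ :- :1 :* qⁱ :* qᵐ :* qᵐ :* a :* a :* b :* b :* c :* c :* d :* d :* q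
                                       :* q
                                    :+ qⁱ :* qᵐ :* a :* b :* q :* q
                                    :+ :- :1 :* qⁱ :* qᵐ :* qᵐ :* a :* a :* b :* b :* c :* d :* q :* q :* q
                                    :+ :- :1 :* qⁱ :* qᵐ :* qᵐ :* a :* b :* c :* d :* q :* q
                                    :+ qⁱ :* qᵐ :* qᵐ :* qᵐ :* a :* a :* b :* b :* c :* c :* d :* d :* q :* q
                                       :* q)))
            refl z₀ z₁ P₀ P₂ G⁻¹ ((1# - (a * q) * b) ⁻¹)
            (q ^ i) q a b c d (q ^ m) ⟩
      _ ≈⟨ x+[u-v]*y≈x z₀qᵐ≈1 _ _ ⟩
      _ ≈⟨ x+[u-v]*y≈x z₁qqᵐ≈1 _ _ ⟩
      _ ≈⟨ x+[u-v]*y≈x (x*x⁻¹≈1 1-[aq]b≉0) _ _ ⟩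
      (q * q ^ m) * (β * (((1# - z₁) * P₀ * (P₂ * (1# - w (suc (suc m)) * q ^ i))) * G⁻¹ * q ^ suc i)
                    - α * (((P₀ * (1# - z₀ * q ^ i)) * ((1# - w (suc m)) * P₂)) * G⁻¹ * q ^ suc i))
        ≈⟨ *-congˡ (+-cong (*-congˡ (*-congʳ (*-congʳ (*-cong (sym (poch-unconsˡ i z₁q≈z₀))
                                                              (sym (poch-cong q (suc i) w[aq,bq]≈w[m+2]))))))
                           (-‿cong (*-congˡ (*-congʳ (*-congʳ (*-congˡ (sym (poch-unconsˡ i (*-assoc _ _ _))))))))) ⟩
      (q * q ^ m) * (β * coeff z₁ w[aq,bq] (a * q) (b * q) c d q (suc i)
                    - α * coeff z₀ (w (suc m)) (a * q) (b * q) c d q (suc i)) ∎)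
      where
      G⁻¹ = denom (a * q) (b * q) c d q (suc i) ⁻¹
      P₀ = poch z₀ q i
      P₂ = poch (w (suc (suc m))) q i

    u : Carrier
    u = θ-factor a q x 0

    S[a,b]₁ S[a,b]₂ S[a,bq]₁ S[aq,b]₁ S[aq,bq]₁ S[aq,bq]₀ : Carrier
    S[a,b]₁ = sumTo (term z₁ (w m) a b c d q x) (suc m)
    S[a,b]₂ = sumTo (term z₂ (w (suc m)) a b c d q x) (suc (suc m))
    S[a,bq]₁ = sumTo (term z₁ w[a,bq] a (b * q) c d q x) (suc m)
    S[aq,b]₁ = sumTo (term z₁ w[aq,b] (a * q) b c d q x) (suc m)
    S[aq,bq]₁ = sumTo (term z₁ w[aq,bq] (a * q) (b * q) c d q x) (suc m)
    S[aq,bq]₀ = sumTo (term z₀ (w (suc m)) (a * q) (b * q) c d q x) m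

    sum-I : S[a,b]₁ - S[a,bq]₁ ≈ τ₁ * (u * S[aq,bq]₀)
    sum-I = trans
      (sumTo-suc-difference _ _ (λ i → u * term z₀ (w (suc m)) (a * q) (b * q) c d q x i) τ₁ m refl (λ i →
        trans (term-difference x i (relation-I i))
              (*-congˡ (*-congˡ (sym (term≈coeff*pochθ z₀ (w (suc m)) (a * q) (b * q) c d q x i))))))
      (*-congˡ (sumTo-*ˡ u _ m))

    sum-II : S[a,b]₂ - S[a,bq]₁ ≈ τ₂ * (u * S[aq,bq]₁)
    sum-II = trans
      (+-congˡ (-‿cong (sym (sumTo-zero-lastʳ _ (suc m)
        (term-vanishes w[a,bq] a (b * q) c d q x (suc (suc m)) (poch-q⁻ʳ-vanishes q≉0 (suc m)))))))
      (trans
        (sumTo-suc-difference _ _ (λ i → u * term z₁ w[aq,bq] (a * q) (b * q) c d q x i) τ₂ (suc m) refl (λ i →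
          trans (term-difference x i (relation-II i))
                (*-congˡ (*-congˡ (sym (term≈coeff*pochθ z₁ w[aq,bq] (a * q) (b * q) c d q x i))))))
        (*-congˡ (sumTo-*ˡ u _ (suc m))))

    sum-III : γ * S[aq,b]₁ ≈ β * S[aq,bq]₁ - α * S[aq,bq]₀
    sum-III = trans
      (sumTo-combination _ _ _ α β γ (suc m) (λ k → term-combination x k (relation-III k)))
      (+-congˡ (-‿cong (*-congˡ (sumTo-zero-lastʳ _ m
        (term-vanishes (w (suc m)) (a * q) (b * q) c d q x (suc m) (poch-q⁻ʳ-vanishes q≉0 m))))))

    ατ₂≈βτ₁ : α * τ₂ ≈ β * τ₁
    ατ₂≈βτ₁ = begin
      α * τ₂  ≈⟨ solve 9 (λ z₁ z₂ D₀⁻¹ q a b c d qᵐ →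
                      q :* a :* b :* (:1 :- qᵐ :* q) :* (:1 :- c :* d :* qᵐ)
                      :* ((:1 :- a :* b :* c :* d :* (qᵐ :* q)) :* q :* (a :* b :- z₂) :* D₀⁻¹)
                      := (:1 :- a :* b :* c :* d :* (qᵐ :* q)) :* (:1 :- a :* b :* (qᵐ :* q :* q))
                         :* (q :* (:1 :- z₁) :* (a :* b :* (:1 :- c :* d :* qᵐ)) :* D₀⁻¹)
                         :+ (z₂ :* q :- z₁)
                            :* (a :* b :* (:1 :- c :* d :* qᵐ) :* (:1 :- a :* b :* c :* d :* (qᵐ :* q)) :* q
                                :* D₀⁻¹ :* (qᵐ :* q :- :1))
                         :+ (z₁ :* q :* qᵐ :- :1)
                            :* (a :* b :* (:1 :- c :* d :* qᵐ) :* (:1 :- a :* b :* c :* d :* (qᵐ :* q)) :* q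
                                :* D₀⁻¹ :* (:1 :- a :* b :* q)))
            refl z₁ z₂ (D₀ ⁻¹) q a b c d (q ^ m) ⟩
      _       ≈⟨ x+[u-v]*y≈x z₁qqᵐ≈1 _ _ ⟩
      _       ≈⟨ x+[u-v]*y≈x z₂q≈z₁ _ _ ⟩
      β * τ₁  ∎

    sum-identity : α * (S[a,b]₂ * S[aq,bq]₀) - (β * (S[a,b]₁ * S[aq,bq]₁) - γ * (S[aq,b]₁ * S[a,bq]₁))
                   ≈ 0#
    sum-identity = begin
      α * (X₂ * Y₀) - (β * (X₁ * Y₁) - γ * (U * V))
        ≈⟨ solve 12 (λ α β γ X₂ Y₀ X₁ Y₁ U V τ₁ τ₂ u →
             α :* (X₂ :* Y₀) :- (β :* (X₁ :* Y₁) :- γ :* (U :* V)) :=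
             (α :* Y₀) :* ((X₂ :- V) :- τ₂ :* (u :* Y₁)) :+ (:- (β :* Y₁)) :* ((X₁ :- V) :- τ₁ :* (u :* Y₀))
             :+ V :* (γ :* U :- (β :* Y₁ :- α :* Y₀)) :+ (u :* Y₀ :* Y₁) :* (α :* τ₂ :- β :* τ₁))
             refl α β γ X₂ Y₀ X₁ Y₁ U V τ₁ τ₂ u ⟩
      (α * Y₀) * ((X₂ - V) - τ₂ * (u * Y₁)) + (- (β * Y₁)) * ((X₁ - V) - τ₁ * (u * Y₀))
        + V * (γ * U - (β * Y₁ - α * Y₀)) + (u * Y₀ * Y₁) * (α * τ₂ - β * τ₁)
        ≈⟨ +-cong (+-cong (+-cong (r*[s-t]≈0 sum-II) (r*[s-t]≈0 sum-I)) (r*[s-t]≈0 sum-III)) (r*[s-t]≈0 ατ₂≈βτ₁) ⟩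
      0# + 0# + 0# + 0#
        ≈⟨ solve 0 (:0 :+ :0 :+ :0 :+ :0 := :0) refl ⟩
      0# ∎
      where
      X₂ = S[a,b]₂
      X₁ = S[a,b]₁
      Y₁ = S[aq,bq]₁
      Y₀ = S[aq,bq]₀
      U = S[aq,b]₁
      V = S[a,bq]₁
      r*[s-t]≈0 : ∀ {r s t} → s ≈ t → r * (s - t) ≈ 0#
      r*[s-t]≈0 s≈t = y≈0⇒x*y≈0 (x≈y⇒x-y≈0 s≈t)

    p[a,b]₂ p[a,b]₁ p[aq,bq]₁ p[aq,bq]₀ p[aq,b]₁ p[a,bq]₁ : Carrier
    p[a,b]₂ = p (suc (suc m)) x a b c d q
    p[a,b]₁ = p (suc m) x a b c d q
    p[aq,bq]₁ = p (suc m) x (a * q) (b * q) c d q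
    p[aq,bq]₀ = p m x (a * q) (b * q) c d q
    p[aq,b]₁ = p (suc m) x (a * q) b c d q
    p[a,bq]₁ = p (suc m) x a (b * q) c d q

    Π[ab] Π[ac] Π[ad] Ω : Carrier
    Π[ab] = poch ((a * q) * (b * q)) q m
    Π[ac] = poch ((a * q) * c) q m
    Π[ad] = poch ((a * q) * d) q m
    Ω = Π[ab] * Π[ab] * Π[ac] * Π[ac] * Π[ad] * Π[ad] * (1# - a * c) * (1# - a * d)
        * (1# - a * c * q ^ suc m) * (1# - a * d * q ^ suc m) * (a ^ suc m) ⁻¹ * ((a * q) ^ m) ⁻¹ * a ⁻¹

    a^[m+2]⁻¹ : (a ^ suc (suc m)) ⁻¹ ≈ (a ^ suc m) ⁻¹ * a ⁻¹
    a^[m+2]⁻¹ = ⁻¹-distrib-* (^-nonzero a≉0 (suc m)) a≉0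

    [aq]^[m+1]⁻¹ : ((a * q) ^ suc m) ⁻¹ ≈ ((a * q) ^ m) ⁻¹ * (a ⁻¹ * q ⁻¹)
    [aq]^[m+1]⁻¹ = trans (⁻¹-distrib-* (^-nonzero aq≉0 m) aq≉0) (*-congˡ (⁻¹-distrib-* a≉0 q≉0))
      where
      aq≉0 = *-nonzero a≉0 q≉0

    poch[ab]ₘ₊₂ : poch (a * b) q (suc (suc m)) ≈ (1# - a * b) * ((1# - a * b * q) * Π[ab])
    poch[ab]ₘ₊₂ = trans (poch-unconsˡ (suc m) refl)
      (*-congˡ (poch-unconsˡ m (solve 3 (λ a b q → a :* b :* q :* q := (a :* q) :* (b :* q)) refl a b q)))

    poch[[aq]b]ₘ₊₁ : poch ((a * q) * b) q (suc m) ≈ (1# - (a * q) * b) * Π[ab]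
    poch[[aq]b]ₘ₊₁ = poch-unconsˡ m (solve 3 (λ a b q → (a :* q) :* b :* q := (a :* q) :* (b :* q)) refl a b q)

    sum[aq,bq]-cong : ∀ n →
      sumTo (term ((q ⁻¹) ^ n) ((a * q) * (b * q) * c * d * q ^ (n ∸ 1)) (a * q) (b * q) c d q x) n ≈
      sumTo (term ((q ⁻¹) ^ n) (w (suc n)) (a * q) (b * q) c d q x) n
    sum[aq,bq]-cong zero = refl
    sum[aq,bq]-cong (suc n) = sumTo-cong (suc n) (λ k → *-congʳ (*-congʳ (*-congʳ (*-congˡ (poch-cong q k
      (solve 6 (λ a b c d q qⁿ → (a :* q) :* (b :* q) :* c :* d :* qⁿ := a :* b :* c :* d :* ((qⁿ :* q) :* q))
         refl a b c d q (q ^ n)))))))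

    p[a,b]₂*p[aq,bq]₀≈ : p[a,b]₂ * p[aq,bq]₀ ≈
                         Ω * ((1# - a * b) * (1# - a * b * q)) * (S[a,b]₂ * S[aq,bq]₀)
    p[a,b]₂*p[aq,bq]₀≈ = trans
      (*-cong (*-congʳ (*-cong (*-cong (*-cong poch[ab]ₘ₊₂ (*-congʳ (poch[ay]-unconsˡ c m)))
                                        (*-congʳ (poch[ay]-unconsˡ d m)))
                               a^[m+2]⁻¹))
              (*-congˡ (sum[aq,bq]-cong m)))
      (solve 15 (λ a b c d q qᵐ Πab Πac Πad A B a⁻¹ q⁻¹ X Y →
                      (:1 :- a :* b) :* ((:1 :- a :* b :* q) :* Πab)
                      :* ((:1 :- a :* c) :* Πac :* (:1 :- a :* c :* (qᵐ :* q)))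
                      :* ((:1 :- a :* d) :* Πad :* (:1 :- a :* d :* (qᵐ :* q))) :* (A :* a⁻¹) :* X
                      :* (Πab :* Πac :* Πad :* B :* Y)
                      := Πab :* Πab :* Πac :* Πac :* Πad :* Πad :* (:1 :- a :* c) :* (:1 :- a :* d)
                         :* (:1 :- a :* c :* (qᵐ :* q)) :* (:1 :- a :* d :* (qᵐ :* q)) :* A :* B :* a⁻¹
                         :* ((:1 :- a :* b) :* (:1 :- a :* b :* q)) :* (X :* Y))
            refl a b c d q (q ^ m) Π[ab] Π[ac] Π[ad] ((a ^ suc m) ⁻¹) (((a * q) ^ m) ⁻¹) (a ⁻¹)
            (q ⁻¹) S[a,b]₂ S[aq,bq]₀)

    p[a,b]₁*p[aq,bq]₁≈ : (p[a,b]₁ * p[aq,bq]₁) * (1# - a * b * q ^ suc m) ≈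
                         Ω * ((1# - a * b) * (1# - a * b * q)) * ((1# - (a * q) * (b * q) * q ^ m) * q ⁻¹)
                           * (S[a,b]₁ * S[aq,bq]₁)
    p[a,b]₁*p[aq,bq]₁≈ = trans
      (solve 7 (λ P Pc Pd A S G K → P :* Pc :* Pd :* A :* S :* G :* K := P :* K :* Pc :* Pd :* A :* S :* G)
         refl (poch (a * b) q (suc m)) (poch (a * c) q (suc m)) (poch (a * d) q (suc m)) ((a ^ suc m) ⁻¹)
         S[a,b]₁ p[aq,bq]₁ (1# - a * b * q ^ suc m))
      (trans (*-cong (*-congʳ (*-congʳ (*-cong (*-cong poch[ab]ₘ₊₂ (poch[ay]-unconsˡ c m)) (poch[ay]-unconsˡ d m))))
                     (*-congʳ (*-congˡ [aq]^[m+1]⁻¹)))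
             (solve 15 (λ a b c d q qᵐ Πab Πac Πad A B a⁻¹ q⁻¹ X Y →
                                    (:1 :- a :* b) :* ((:1 :- a :* b :* q) :* Πab) :* ((:1 :- a :* c) :* Πac)
                                    :* ((:1 :- a :* d) :* Πad) :* A :* X
                                    :* (Πab :* (:1 :- a :* q :* (b :* q) :* qᵐ) :* (Πac :* (:1 :- a :* q :* c :* qᵐ))
                                        :* (Πad :* (:1 :- a :* q :* d :* qᵐ)) :* (B :* (a⁻¹ :* q⁻¹)) :* Y)
                                    := Πab :* Πab :* Πac :* Πac :* Πad :* Πad :* (:1 :- a :* c) :* (:1 :- a :* d)
                                       :* (:1 :- a :* c :* (qᵐ :* q)) :* (:1 :- a :* d :* (qᵐ :* q)) :* A :* B :* a⁻¹
                                       :* ((:1 :- a :* b) :* (:1 :- a :* b :* q))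
                                       :* ((:1 :- a :* q :* (b :* q) :* qᵐ) :* q⁻¹) :* (X :* Y))
                   refl a b c d q (q ^ m) Π[ab] Π[ac] Π[ad] ((a ^ suc m) ⁻¹) (((a * q) ^ m) ⁻¹)
                   (a ⁻¹) (q ⁻¹) S[a,b]₁ S[aq,bq]₁))

    p[aq,b]₁*p[a,bq]₁≈ : p[aq,b]₁ * p[a,bq]₁ ≈
                         Ω * ((1# - (a * q) * b) * (1# - a * (b * q))) * q ⁻¹ * (S[aq,b]₁ * S[a,bq]₁)
    p[aq,b]₁*p[a,bq]₁≈ = trans
      (*-cong (*-congʳ (*-cong (*-congʳ (*-congʳ poch[[aq]b]ₘ₊₁)) [aq]^[m+1]⁻¹))
              (*-congʳ (*-congʳ (*-cong (*-cong (poch[ay]-unconsˡ (b * q) m) (poch[ay]-unconsˡ c m))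
                                        (poch[ay]-unconsˡ d m)))))
      (solve 15 (λ a b c d q qᵐ Πab Πac Πad A B a⁻¹ q⁻¹ X Y →
                      (:1 :- a :* q :* b) :* Πab :* (Πac :* (:1 :- a :* q :* c :* qᵐ))
                      :* (Πad :* (:1 :- a :* q :* d :* qᵐ)) :* (B :* (a⁻¹ :* q⁻¹)) :* X
                      :* ((:1 :- a :* (b :* q)) :* Πab :* ((:1 :- a :* c) :* Πac) :* ((:1 :- a :* d) :* Πad)
                          :* A :* Y)
                      := Πab :* Πab :* Πac :* Πac :* Πad :* Πad :* (:1 :- a :* c) :* (:1 :- a :* d)
                         :* (:1 :- a :* c :* (qᵐ :* q)) :* (:1 :- a :* d :* (qᵐ :* q)) :* A :* B :* a⁻¹
                         :* ((:1 :- a :* q :* b) :* (:1 :- a :* (b :* q))) :* q⁻¹ :* (X :* Y))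
            refl a b c d q (q ^ m) Π[ab] Π[ac] Π[ad] ((a ^ suc m) ⁻¹) (((a * q) ^ m) ⁻¹) (a ⁻¹)
            (q ⁻¹) S[aq,b]₁ S[a,bq]₁)

    q^[2m+2] : q ^ (m ℕ.+ suc (suc m)) ≈ q ^ suc m * q ^ suc m
    q^[2m+2] = trans (^-+ q m (suc (suc m)))
      (solve 2 (λ qᵐ q → qᵐ :* ((qᵐ :* q) :* q) := (qᵐ :* q) :* (qᵐ :* q)) refl (q ^ m) q)

    scaled-difference≈0 :
      (1# - a * b * q ^ suc m) *
        (a * b * (1# - q ^ suc m) * (1# - c * d * q ^ m) * p[a,b]₂ * p[aq,bq]₀
         - ((1# - a * b * q ^ suc m) * (1# - a * b * c * d * q ^ suc m) * p[a,b]₁ * p[aq,bq]₁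
            - (1# - a * b) * (1# - a * b * c * d * q ^ (m ℕ.+ suc (suc m))) * p[aq,b]₁ * p[a,bq]₁))
      ≈ 0#
    scaled-difference≈0 = begin
      _ ≈⟨ solve 11 (λ α P₂ P₀ P₁ P₁' Pᵤ Pᵥ K B C C' →
                      K :* (α :* P₂ :* P₀ :- (K :* B :* P₁ :* P₁' :- C :* C' :* Pᵤ :* Pᵥ))
                      := α :* K :* (P₂ :* P₀) :- (K :* B :* (P₁ :* P₁' :* K) :- C :* C' :* K :* (Pᵤ :* Pᵥ)))
             refl (a * b * (1# - q ^ suc m) * (1# - c * d * q ^ m))
             p[a,b]₂ p[aq,bq]₀ p[a,b]₁ p[aq,bq]₁ p[aq,b]₁ p[a,bq]₁
             (1# - a * b * q ^ suc m) (1# - a * b * c * d * q ^ suc m) (1# - a * b)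
             (1# - a * b * c * d * q ^ (m ℕ.+ suc (suc m))) ⟩
      _ ≈⟨ +-cong (*-congˡ p[a,b]₂*p[aq,bq]₀≈)
                  (-‿cong (+-cong (*-congˡ p[a,b]₁*p[aq,bq]₁≈)
                                  (-‿cong (*-cong (*-congʳ (*-congˡ (+-congˡ (-‿cong (*-congˡ q^[2m+2])))))
                                                  p[aq,b]₁*p[a,bq]₁≈)))) ⟩
      _ ≈⟨ solve 14 (λ a b c d q qᵐ Ω q⁻¹ X₁ X₂ V U Y₁ Y₀ →
                      a :* b :* (:1 :- qᵐ :* q) :* (:1 :- c :* d :* qᵐ) :* (:1 :- a :* b :* (qᵐ :* q))
                      :* (Ω :* ((:1 :- a :* b) :* (:1 :- a :* b :* q)) :* (X₂ :* Y₀))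
                      :- ((:1 :- a :* b :* (qᵐ :* q)) :* (:1 :- a :* b :* c :* d :* (qᵐ :* q))
                          :* (Ω :* ((:1 :- a :* b) :* (:1 :- a :* b :* q))
                              :* ((:1 :- a :* q :* (b :* q) :* qᵐ) :* q⁻¹) :* (X₁ :* Y₁))
                          :- (:1 :- a :* b) :* (:1 :- a :* b :* c :* d :* (qᵐ :* q :* (qᵐ :* q)))
                             :* (:1 :- a :* b :* (qᵐ :* q))
                             :* (Ω :* ((:1 :- a :* q :* b) :* (:1 :- a :* (b :* q))) :* q⁻¹ :* (U :* V)))
                      := Ω :* ((:1 :- a :* b) :* (:1 :- a :* b :* q)) :* (:1 :- a :* b :* (qᵐ :* q)) :* q⁻¹
                         :* (q :* a :* b :* (:1 :- qᵐ :* q) :* (:1 :- c :* d :* qᵐ) :* (X₂ :* Y₀)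
                             :- ((:1 :- a :* b :* c :* d :* (qᵐ :* q)) :* (:1 :- a :* b :* (qᵐ :* q :* q))
                                 :* (X₁ :* Y₁)
                                 :- (:1 :- a :* b :* c :* d :* (qᵐ :* q :* (qᵐ :* q))) :* (:1 :- a :* q :* b)
                                    :* (U :* V)))
                         :+ (q :* q⁻¹ :- :1)
                            :* :- (a :* b :* (:1 :- qᵐ :* q) :* (:1 :- c :* d :* qᵐ) :* Ω
                                :* ((:1 :- a :* b) :* (:1 :- a :* b :* q)) :* (:1 :- a :* b :* (qᵐ :* q))
                                :* (X₂ :* Y₀)))
            refl a b c d q (q ^ m) Ω (q ⁻¹) S[a,b]₁ S[a,b]₂ S[a,bq]₁ S[aq,b]₁ S[aq,bq]₁ S[aq,bq]₀ ⟩
      _ ≈⟨ x+[u-v]*y≈x (x*x⁻¹≈1 q≉0) _ _ ⟩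
      _ ≈⟨ y≈0⇒x*y≈0 sum-identity ⟩
      0# ∎

corollary1p3 : ∀ {c ℓ : Level} (F : Field c ℓ) →
    let open Field F hiding (zero) in let open AskeyWilson F in
    (q a b c d x : Carrier) → Generic q a b c d → (n : ℕ) → 1 ≤ n →
      a * b * (1# - q ^ (n ∸ 1)) * (1# - c * d * q ^ (n ∸ 2))
        * p n x a b c d q * p (n ∸ 2) x (a * q) (b * q) c d q
      ≈ (1# - a * b * q ^ (n ∸ 1)) * (1# - a * b * c * d * q ^ (n ∸ 1))
          * p (n ∸ 1) x a b c d q * p (n ∸ 1) x (a * q) (b * q) c d q
        - (1# - a * b) * (1# - a * b * c * d * q ^ (n ℕ.+ n ∸ 2))
          * p (n ∸ 1) x (a * q) b c d q * p (n ∸ 1) x a (b * q) c d q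
corollary1p3 F q a b c d x _ (suc zero) _ =
  solve 6 (λ a b c d P₁ P₀ →
    a :* b :* (:1 :- :1) :* (:1 :- c :* d :* :1) :* P₁ :* P₀
    := (:1 :- a :* b :* :1) :* (:1 :- a :* b :* c :* d :* :1) :* P₀ :* P₀
       :- (:1 :- a :* b) :* (:1 :- a :* b :* c :* d :* :1) :* P₀ :* P₀)
    refl a b c d (p 1 x a b c d q) (p 0 x a b c d q)
  where
  open Field F hiding (zero)
  open AskeyWilson F
  open IntegerCoefficientSolver commutativeRing using (solve; _:=_; _:*_; _:-_; :1)
corollary1p3 F q a b c d x (q≉0 , a≉0 , qʲ⁺¹≉1 , abqʲ≉1 , acqʲ≉1 , adqʲ≉1) (suc (suc m)) _ =
  x-y≈0⇒x≈y (*-cancelˡ (1-nonzero (abqʲ≉1 (suc m))) (trans scaled-difference≈0 (sym (zeroʳ _))))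
  where
  open Field F hiding (zero)
  open FieldProperties F
  open Contiguity.Degree F q a b c d x q≉0 a≉0 qʲ⁺¹≉1 abqʲ≉1 acqʲ≉1 adqʲ≉1 m
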